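{- Fix an integer $k\ge 2$ and consider either edge connectivity or vertex connectivity. Let $G=(V,E)$ be a simple directed graph, $i\in\mathbb{N}$, and $B_i=\{v\in V:\mathrm{InDeg}_G(v)>2^i\}$. If (1) a set of vertices $S$ with $|S|\le 2^i+1$ induces a top SCC in $G$, or (2) there is a set of elements $Z$ with $|Z|<k$ and a set of vertices $S$ with $|S|\le 2^i-k+2$ such that $S$ induces a $k$-almost top SCC with respect to $Z$ in $G$, then $S\subseteq V\setminus B_i$.
   Context: Elements are edges (edge connectivity) or vertices (vertex connectivity); $G\setminus Z$ denotes $G$ with the elements of $Z$ removed. A top SCC (tSCC) is a strongly connected component with no incoming edges from outside it. $S$ induces a $k$-almost tSCC with respect to $Z$ ($|Z|<k$) in $G$ if $G[S]$ is a tSCC of $G\setminus Z$ and, in $G$, for vertex connectivity $S$ has an incoming edge from each vertex of $Z$, and for edge connectivity every edge of $Z$ goes from $V\setminus S$ into $S$. $\mathrm{InDeg}_G(v)$ is the number of edges entering $v$. -}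

module Defs where

open import Data.Nat using (ℕ; _+_; _<_; _≤_; _^_; _<?_)
open import Data.Bool using (Bool; true; false; not; T)
open import Data.Fin using (Fin)
open import Data.Fin.Subset using (Subset; _∈_; _∉_; ∣_∣; ∁; Nonempty)
open import Data.Vec using (tabulate)
open import Data.Product using (Σ; _×_; ∃; ∃-syntax)
open import Data.Unit using (⊤)
open import Data.Nat.ListAction using (sum)
open import Data.List using (map; allFin)
open import Relation.Nullary using (does)
open import Relation.Binary.PropositionalEquality using (_≡_)

-- A simple directed graph on vertex set Fin n: an adjacency relation
-- (edge u → v iff adj u v ≡ true), hence no parallel edges, and no loops.
record Digraph (n : ℕ) : Set where
  field
    adj     : Fin n → Fin n → Bool
    loopless : ∀ v → adj v v ≡ false
open Digraph public

InDeg : ∀ {n} → Digraph n → Fin n → ℕ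
InDeg G v = ∣ tabulate (λ u → adj G u v) ∣

B : ∀ {n} → Digraph n → ℕ → Subset n
B G i = tabulate (λ v → does (2 ^ i <? InDeg G v))

record SubGraph (n : ℕ) : Set₁ where
  field
    alive : Fin n → Set
    edge  : Fin n → Fin n → Set
open SubGraph public

data Reach {n} (H : SubGraph n) : Fin n → Fin n → Set where
  here : ∀ {u} → alive H u → Reach H u u
  step : ∀ {u w v} → alive H u → edge H u w → Reach H w v → Reach H u v

record IsTSCC {n} (H : SubGraph n) (S : Subset n) : Set where
  field
    inside    : ∀ v → v ∈ S → alive H v
    nonempty  : Nonempty S
    strong    : ∀ u v → u ∈ S → v ∈ S → Reach H u v
    maximal   : ∀ u v → u ∈ S → Reach H u v → Reach H v u → v ∈ S
    top       : ∀ u v → alive H u → edge H u v → v ∈ S → u ∈ S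

data Conn : Set where
  edgeConn vertexConn : Conn

Elems : Conn → ℕ → Set
Elems edgeConn   n = Fin n → Fin n → Bool
Elems vertexConn n = Subset n

size : ∀ c {n} → Elems c n → ℕ
size edgeConn   Z = sum (map (λ u → ∣ tabulate (Z u) ∣) (allFin _))
size vertexConn Z = ∣ Z ∣

ElemsOf : ∀ c {n} → Digraph n → Elems c n → Set
ElemsOf edgeConn   G Z = ∀ u v → Z u v ≡ true → adj G u v ≡ true
ElemsOf vertexConn G Z = ⊤

whole : ∀ {n} → Digraph n → SubGraph n
whole G = record { alive = λ _ → ⊤ ; edge = λ u v → adj G u v ≡ true }

remove : ∀ c {n} → Digraph n → Elems c n → SubGraph n
remove edgeConn G Z = record
  { alive = λ _ → ⊤
  ; edge  = λ u v → adj G u v ≡ true × Z u v ≡ false }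
remove vertexConn G Z = record
  { alive = λ v → v ∉ Z
  ; edge  = λ u v → adj G u v ≡ true × u ∉ Z × v ∉ Z }

AlmostCond : ∀ c {n} → Digraph n → Elems c n → Subset n → Set
AlmostCond edgeConn   G Z S = ∀ u v → Z u v ≡ true → u ∉ S × v ∈ S
AlmostCond vertexConn G Z S = ∀ z → z ∈ Z → ∃[ s ] (s ∈ S × adj G z s ≡ true)

record IsAlmostTSCC (k : ℕ) (c : Conn) {n} (G : Digraph n)
                    (Z : Elems c n) (S : Subset n) : Set where
  field
    elems  : ElemsOf c G Z
    small  : size c Z < k
    tscc   : IsTSCC (remove c G Z) S
    cond   : AlmostCond c G Z S

-- Let v ∈ S. Because S is a top SCC of G ∖ Z, every in-neighbour u of v whose edge
-- survives the removal of Z lies in S, and u ≠ v since G has no loops. The in-neighbours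
-- of v therefore lie in (S − v) ∪ X, where X is the set of in-neighbours cut off by Z
-- (the tails of the edges of Z into v, or the vertices of Z), and |X| ≤ |Z| < k.
-- Hence InDeg(v) ≤ |S| − 1 + k − 1 ≤ 2^i; with Z = ∅ this is InDeg(v) ≤ |S| − 1 ≤ 2^i.
module Submission where

open import Defs
open import Data.Nat using (ℕ; _+_; _<_; _≤_; _^_)
open import Data.Fin.Subset using (Subset; ∣_∣; ∁; _⊆_)
open import Data.Product using (Σ; _×_)
open import Data.Sum using (_⊎_)

open import Data.Nat using (zero; suc; z≤n; s≤s; _<?_)
open import Data.Nat.Properties
open import Data.Nat.ListAction using (sum)
open import Data.Bool using (Bool; true; false)
open import Data.Fin using (Fin)
import Data.Fin as Fin
open import Data.Fin.Subset using (_∈_; _∪_; _-_; inside; outside)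
open import Data.Fin.Subset.Properties
  using (p⊆q⇒∣p∣≤∣q∣; x∈p⇒∣p-x∣<∣p∣; x∈p∪q⁺; x∈p∧x≢y⇒x∈p-y; x∉p⇒x∈∁p; _∈?_)
open import Data.Vec using (_∷_; []; tabulate)
open import Data.Vec.Properties using (lookup∘tabulate; lookup⇒[]=; []=⇒lookup)
import Data.List as List
open import Data.List.Properties using (map-tabulate)
open import Data.Product using (_,_)
open import Data.Sum using (inj₁; inj₂)
open import Data.Unit using (tt)
open import Function using (_∘_; case_of_)
open import Relation.Nullary using (yes; no)
open import Relation.Nullary.Decidable using (dec-false)
open import Relation.Binary.PropositionalEquality

private
  variable
    n m : ℕ

∈-tabulate⁺ : {f : Fin n → Bool} {u : Fin n} → f u ≡ true → u ∈ tabulate f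
∈-tabulate⁺ {f = f} {u} fu = lookup⇒[]= u (tabulate f) (trans (lookup∘tabulate f u) fu)

∈-tabulate⁻ : {f : Fin n → Bool} {u : Fin n} → u ∈ tabulate f → f u ≡ true
∈-tabulate⁻ {f = f} {u} u∈ = trans (sym (lookup∘tabulate f u)) ([]=⇒lookup u∈)

x∈p⇒1≤∣p∣ : {x : Fin n} {p : Subset n} → x ∈ p → 1 ≤ ∣ p ∣
x∈p⇒1≤∣p∣ x∈p = ≤-trans (s≤s z≤n) (x∈p⇒∣p-x∣<∣p∣ x∈p)

∣p∪q∣≤∣p∣+∣q∣ : (p q : Subset n) → ∣ p ∪ q ∣ ≤ ∣ p ∣ + ∣ q ∣
∣p∪q∣≤∣p∣+∣q∣ []            []            = z≤n
∣p∪q∣≤∣p∣+∣q∣ (outside ∷ p) (outside ∷ q) = ∣p∪q∣≤∣p∣+∣q∣ p q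
∣p∪q∣≤∣p∣+∣q∣ (outside ∷ p) (inside  ∷ q) =
  ≤-trans (s≤s (∣p∪q∣≤∣p∣+∣q∣ p q)) (≤-reflexive (sym (+-suc ∣ p ∣ ∣ q ∣)))
∣p∪q∣≤∣p∣+∣q∣ (inside  ∷ p) (outside ∷ q) = s≤s (∣p∪q∣≤∣p∣+∣q∣ p q)
∣p∪q∣≤∣p∣+∣q∣ (inside  ∷ p) (inside  ∷ q) =
  s≤s (≤-trans (∣p∪q∣≤∣p∣+∣q∣ p q) (+-monoʳ-≤ ∣ p ∣ (n≤1+n ∣ q ∣)))

∣p∣<∣q∣+∣r∣ : {x : Fin n} {p q r : Subset n} → x ∈ q → p ⊆ (q - x) ∪ r → ∣ p ∣ < ∣ q ∣ + ∣ r ∣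
∣p∣<∣q∣+∣r∣ {x = x} {p} {q} {r} x∈q p⊆ = begin-strict
  ∣ p ∣             ≤⟨ p⊆q⇒∣p∣≤∣q∣ p⊆ ⟩
  ∣ (q - x) ∪ r ∣   ≤⟨ ∣p∪q∣≤∣p∣+∣q∣ (q - x) r ⟩
  ∣ q - x ∣ + ∣ r ∣ <⟨ +-monoˡ-< ∣ r ∣ (x∈p⇒∣p-x∣<∣p∣ x∈q) ⟩
  ∣ q ∣ + ∣ r ∣     ∎
  where open ≤-Reasoning

∣column∣≤∑∣rows∣ : (M : Fin n → Fin m → Bool) (v : Fin m) →
                   ∣ tabulate (λ u → M u v) ∣ ≤ sum (List.tabulate (λ u → ∣ tabulate (M u) ∣))
∣column∣≤∑∣rows∣ {zero}  M v = z≤n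
∣column∣≤∑∣rows∣ {suc n} M v with M Fin.zero v in eq
... | true  = +-mono-≤ (x∈p⇒1≤∣p∣ (∈-tabulate⁺ {f = M Fin.zero} eq)) (∣column∣≤∑∣rows∣ (M ∘ Fin.suc) v)
... | false = ≤-trans (∣column∣≤∑∣rows∣ (M ∘ Fin.suc) v) (m≤n+m _ _)

inNeighbours : Digraph n → Fin n → Subset n
inNeighbours G v = tabulate (λ u → adj G u v)

adj⇒≢ : (G : Digraph n) {u v : Fin n} → adj G u v ≡ true → u ≢ v
adj⇒≢ G {u} e refl with () ← trans (sym e) (loopless G u)

tscc-pred∈ : {H : SubGraph n} {S : Subset n} {u v : Fin n} → IsTSCC H S →
             alive H u → edge H u v → v ∈ S → u ≢ v → u ∈ S - v
tscc-pred∈ t alive-u uv v∈S u≢v = x∈p∧x≢y⇒x∈p-y (IsTSCC.top t _ _ alive-u uv v∈S) u≢v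

inNeighbours⊆S-v : (G : Digraph n) {S : Subset n} {v : Fin n} →
                   IsTSCC (whole G) S → v ∈ S → inNeighbours G v ⊆ S - v
inNeighbours⊆S-v G t v∈S u∈N = tscc-pred∈ t tt e v∈S (adj⇒≢ G e)
  where e = ∈-tabulate⁻ u∈N

-- The in-neighbours of v that lose their edge to v when Z is removed.
cutOff : ∀ c → Elems c n → Fin n → Subset n
cutOff edgeConn   Z v = tabulate (λ u → Z u v)
cutOff vertexConn Z v = Z

∣cutOff∣≤size : ∀ c (Z : Elems c n) (v : Fin n) → ∣ cutOff c Z v ∣ ≤ size c Z
∣cutOff∣≤size edgeConn Z v = subst (∣ tabulate (λ u → Z u v) ∣ ≤_)
  (cong sum (sym (map-tabulate (λ u → u) (λ u → ∣ tabulate (Z u) ∣))))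
  (∣column∣≤∑∣rows∣ Z v)
∣cutOff∣≤size vertexConn Z v = ≤-refl

inNeighbours⊆S-v∪cutOff : ∀ c (G : Digraph n) (Z : Elems c n) {S : Subset n} {v : Fin n} →
                          IsTSCC (remove c G Z) S → v ∈ S →
                          inNeighbours G v ⊆ (S - v) ∪ cutOff c Z v
inNeighbours⊆S-v∪cutOff edgeConn G Z {v = v} t v∈S {u} u∈N with Z u v in eq
... | true  = x∈p∪q⁺ (inj₂ (∈-tabulate⁺ eq))
... | false = x∈p∪q⁺ (inj₁ (tscc-pred∈ t tt (e , eq) v∈S (adj⇒≢ G e)))
  where e = ∈-tabulate⁻ u∈N
inNeighbours⊆S-v∪cutOff vertexConn G Z t v∈S {u} u∈N with u ∈? Z
... | yes u∈Z = x∈p∪q⁺ (inj₂ u∈Z)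
... | no  u∉Z = x∈p∪q⁺ (inj₁ (tscc-pred∈ t u∉Z (e , u∉Z , IsTSCC.inside t _ v∈S) v∈S (adj⇒≢ G e)))
  where e = ∈-tabulate⁻ u∈N

InDeg≤⇒∈∁B : (G : Digraph n) (i : ℕ) {v : Fin n} → InDeg G v ≤ 2 ^ i → v ∈ ∁ (B G i)
InDeg≤⇒∈∁B G i {v} d≤ = x∉p⇒x∈∁p λ v∈B →
  case trans (sym (∈-tabulate⁻ v∈B)) (dec-false (2 ^ i <? InDeg G v) (≤⇒≯ d≤)) of λ ()

a<b+c∧c<k∧b+k≤m+2⇒a≤m : ∀ {a b c k m} → a < b + c → c < k → b + k ≤ m + 2 → a ≤ m
a<b+c∧c<k∧b+k≤m+2⇒a≤m {a} {b} {c} {k} {m} a<b+c c<k b+k≤m+2 = +-cancelʳ-≤ 2 a m (begin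
  a + 2       ≡⟨ +-comm a 2 ⟩
  suc (suc a) ≤⟨ s≤s a<b+c ⟩
  suc (b + c) ≡⟨ +-suc b c ⟨
  b + suc c   ≤⟨ +-monoʳ-≤ b c<k ⟩
  b + k       ≤⟨ b+k≤m+2 ⟩
  m + 2       ∎)
  where open ≤-Reasoning

mainTheorem12 : (k : ℕ) → 2 ≤ k → (c : Conn) → {n : ℕ} → (G : Digraph n) → (i : ℕ) → (S : Subset n)
    → ((∣ S ∣ ≤ 2 ^ i + 1 × IsTSCC (whole G) S)
       ⊎ Σ (Elems c n) (λ Z → ∣ S ∣ + k ≤ 2 ^ i + 2 × IsAlmostTSCC k c G Z S))
    → S ⊆ ∁ (B G i)
mainTheorem12 k _ c G i S (inj₁ (∣S∣≤ , t)) {v} v∈S = InDeg≤⇒∈∁B G i (≤-pred (begin-strict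
  InDeg G v ≤⟨ p⊆q⇒∣p∣≤∣q∣ (inNeighbours⊆S-v G t v∈S) ⟩
  ∣ S - v ∣ <⟨ x∈p⇒∣p-x∣<∣p∣ v∈S ⟩
  ∣ S ∣     ≤⟨ ∣S∣≤ ⟩
  2 ^ i + 1 ≡⟨ +-comm (2 ^ i) 1 ⟩
  suc (2 ^ i) ∎))
  where open ≤-Reasoning
mainTheorem12 k _ c G i S (inj₂ (Z , ∣S∣+k≤ , a)) {v} v∈S = InDeg≤⇒∈∁B G i
  (a<b+c∧c<k∧b+k≤m+2⇒a≤m
    (∣p∣<∣q∣+∣r∣ v∈S (inNeighbours⊆S-v∪cutOff c G Z tscc v∈S))
    (≤-<-trans (∣cutOff∣≤size c Z v) small)
    ∣S∣+k≤)
  where open IsAlmostTSCC a
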